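{- Let $\tau=(\tau_1,\dots,\tau_\ell)\in\mathbb{Z}_{>0}^\ell$, $0\le k\le\ell-1$, let $\hat P_\tau=C\sqcup O$ be the $k$-decomposition and $\hat P_\tau=C'\sqcup O'$ the $(k+1)$-decomposition. Let $F$ be a nonempty face of $\mathcal{O}_{C,O}(\tau)$ and let $\pi$ be its face partition of $O$ (two elements $p,q\in O$ lie in the same block iff $x_p=x_q$ for all $x\in F$). Define $$\pi''=\{K\cap O' : K\in\pi,\ K\not\subseteq Y^{k+1}\cup Y^{k+2}\},$$ and let $\pi'$ be the partition of $O'$ obtained from $\pi''$ by adding every element of $O'$ not contained in a block of $\pi''$ as a singleton block. Then every block of $\pi''$ is connected as an induced subposet of $\hat P_\tau$; consequently every block of $\pi'$ is connected.
   Context: For $\tau=(\tau_1,\dots,\tau_\ell)$ a tuple of positive integers, $P_\tau$ is the poset with ranks $Y^1,\dots,Y^\ell$, $|Y^i|=\tau_i$, and $y<z$ for $y\in Y^i,z\in Y^j$ iff $i<j$; $\hat P_\tau$ adds a minimum $\hat0$ and maximum $\hat1$, with $Y^0=\{\hat0\}$, $Y^{\ell+1}=\{\hat1\}$; covering relations are the pairs $p\in Y^i$, $q\in Y^{i+1}$. For $0\le k\le\ell$ the $k$-decomposition is $C=\bigcup_{i=0}^kY^i$, $O=\bigcup_{i=k+1}^{\ell+1}Y^i$. The chain-order polytope $\mathcal{O}_{C,O}(\tau)\subseteq\mathbb{R}^{\hat P_\tau}$ is defined by $x_{\hat0}=0$, $x_{\hat1}=1$, $0\le x_p$ for $p\in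 C$, the order inequalities $x_a\le x_b$ for covering relations $a\prec b$ with $a,b\in O$, and the chain inequalities $x_{p_1}+\dots+x_{p_k}\le x_q$ for all $p_i\in Y^i$ ($1\le i\le k$), $q\in Y^{k+1}$. A subset of a poset is connected if its comparability graph (as an induced subposet) is connected.
   Formalization: The chain-order polytope, its faces and the face partition π are taken over ℚ, with rational points and rational valid inequalities, rather than over ℝ. -}

module Defs where

open import Data.Nat as ℕ using (ℕ; zero; suc; _<ᵇ_)
open import Data.Fin using (Fin; toℕ)
open import Data.List using (List; []; _∷_; map; concatMap; foldr)
open import Data.List.Base using (allFin)
open import Data.Bool using (if_then_else_)
open import Data.Rational as ℚ using (ℚ; 0ℚ; 1ℚ; _+_; _*_; _≤_)
open import Data.Product using (Σ; _×_; _,_; ∃)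
open import Data.Sum using (_⊎_)
open import Relation.Binary.PropositionalEquality using (_≡_)
open import Relation.Nullary using (¬_)

-- Elements of the bounded poset  P̂_τ  for  τ = (τ 0, …, τ (ℓ-1)).
-- `mid i j` is the j-th element of the rank Y^(i+1).
data Elem {ℓ : ℕ} (τ : Fin ℓ → ℕ) : Set where
  bot : Elem τ
  mid : (i : Fin ℓ) → Fin (τ i) → Elem τ
  top : Elem τ

module _ {ℓ : ℕ} (τ : Fin ℓ → ℕ) where

  rank : Elem τ → ℕ
  rank bot       = 0
  rank (mid i _) = suc (toℕ i)
  rank top       = suc ℓ

  _<P_ : Elem τ → Elem τ → Set
  a <P b = rank a ℕ.< rank b

  Comparable : Elem τ → Elem τ → Set
  Comparable a b = (a <P b) ⊎ (b <P a)

  data Walk (S : Elem τ → Set) : Elem τ → Elem τ → Set where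
    here : ∀ {a} → Walk S a a
    step : ∀ {a c b} → Comparable a c → S c → Walk S c b → Walk S a b

  Connected : (Elem τ → Set) → Set
  Connected S = ∀ a b → S a → S b → Walk S a b

  allElems : List (Elem τ)
  allElems = bot ∷ top ∷ concatMap (λ i → map (mid i) (allFin (τ i))) (allFin ℓ)

  sumℚ : List ℚ → ℚ
  sumℚ = foldr _+_ 0ℚ

  Point : Set
  Point = Elem τ → ℚ

  lin : Point → Point → ℚ
  lin c x = sumℚ (map (λ p → c p * x p) allElems)

  -- x_{p_1} + … + x_{p_k} for a transversal s (only ranks 1..k used)
  chainSum : ℕ → Point → ((i : Fin ℓ) → Fin (τ i)) → ℚ
  chainSum k x s = sumℚ (map (λ i → if toℕ i <ᵇ k then x (mid i (s i)) else 0ℚ) (allFin ℓ))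

  InC : ℕ → Elem τ → Set
  InC k p = rank p ℕ.≤ k

  InO : ℕ → Elem τ → Set
  InO k p = k ℕ.< rank p

  record InPoly (k : ℕ) (x : Point) : Set where
    field
      bot-zero : x bot ≡ 0ℚ
      top-one  : x top ≡ 1ℚ
      nonneg   : ∀ p → InC k p → 0ℚ ≤ x p
      order    : ∀ a b → InO k a → InO k b → rank b ≡ suc (rank a) → x a ≤ x b
      chain    : ∀ (s : (i : Fin ℓ) → Fin (τ i)) (q : Elem τ) →
                 rank q ≡ suc k → chainSum k x s ≤ x q

  ValidIneq : ℕ → Point → ℚ → Set
  ValidIneq k c b = ∀ x → InPoly k x → lin c x ≤ b

  InFace : ℕ → Point → ℚ → Point → Set
  InFace k c b x = InPoly k x × lin c x ≡ b

  SameBlock : ℕ → Point → ℚ → Elem τ → Elem τ → Set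
  SameBlock k c b p q = InO k p × InO k q × (∀ x → InFace k c b x → x p ≡ x q)

  -- the block K of π containing p (p ∈ O) is not contained in Y^{k+1} ∪ Y^{k+2}
  Qualifies : ℕ → Point → ℚ → Elem τ → Set
  Qualifies k c b p = ∃ λ r → SameBlock k c b p r × suc (suc k) ℕ.< rank r

  -- K ∩ O'  where K is the π-block of p
  π''Block : ℕ → Point → ℚ → Elem τ → Elem τ → Set
  π''Block k c b p q = SameBlock k c b p q × InO (suc k) q

  π'Block : ℕ → Point → ℚ → Elem τ → Elem τ → Set
  π'Block k c b p q = (Qualifies k c b p × π''Block k c b p q) ⊎ (¬ Qualifies k c b p × q ≡ p)

-- Let a ≠ a′ be tied on the face F (x_a = x_a′ on F) and of the same rank ≥ k + 3, so
-- that x_a occurs only in order inequalities with its cover neighbours q.  For each such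
-- q, either no optimal up-set of O (an up-set Φ maximising c · 1_Φ) separates q from a, and
-- then a threshold argument ties a to q on F, or some optimal up-set does.  If every
-- neighbour is separated, pushing a face point towards the average of all optimal up-sets
-- gives a face point with strict inequalities around a; moving x_a alone then stays on F,
-- which breaks the tie with a′ unless x_a = 1 = x_1̂ on F.  In every case a is tied to an
-- element of O′ of another rank, through which a and a′ are connected.  Separation by an
-- optimal up-set is decidable by enumerating all subsets, which makes this case split
-- constructive.

module Submission where

open import Defs
open import Level using (0ℓ)
open import Data.Bool using (Bool; true; false; if_then_else_; T)
import Data.Bool.Properties as Boolₚ
open import Data.Empty using (⊥-elim)
open import Data.Fin using (Fin; toℕ; fromℕ<)
import Data.Fin.Properties as Finₚ
open import Data.List using (List; []; _∷_; map; _++_; allFin; filter)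
open import Data.List.Membership.Propositional using (_∈_)
import Data.List.Membership.Propositional.Properties as ∈ₚ
import Data.List.Properties as Listₚ
open import Data.List.Relation.Unary.All as All using (All; all?; []; _∷_)
open import Data.List.Relation.Unary.Any as Any using (here; there; any?)
open import Data.Nat as ℕ using (ℕ; zero; suc; z≤n; s≤s; _<ᵇ_)
import Data.Nat.Properties as ℕₚ
open import Data.Product using (∃; ∃-syntax; _×_; _,_; proj₁; proj₂)
open import Data.Rational using (ℚ; 0ℚ; 1ℚ; ½; _+_; _*_; _-_; -_; _≤_; _<_; _⊓_; positive; nonNegative)
import Data.Rational.Properties as ℚₚ
open import Data.Sum using (_⊎_; inj₁; inj₂)
open import Data.Unit using (tt)
open import Function using (_∘_; flip)
open import Relation.Binary.Definitions using (DecidableEquality; tri<; tri≈; tri>)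
open import Relation.Binary.PropositionalEquality
open import Relation.Nullary using (¬_; Dec; yes; no; ⌊_⌋)
open import Relation.Nullary.Decidable using (dec⇒maybe; map′; _×-dec_; _⊎-dec_; _→-dec_; ¬?)
open import Relation.Unary using (Decidable)
open import Tactic.RingSolver using (solve-∀)
open import Tactic.RingSolver.Core.AlmostCommutativeRing using (AlmostCommutativeRing; fromCommutativeRing)


ℚ-ring : AlmostCommutativeRing 0ℓ 0ℓ
ℚ-ring = fromCommutativeRing ℚₚ.+-*-commutativeRing (λ p → dec⇒maybe (0ℚ ℚₚ.≟ p))

0<1 : 0ℚ < 1ℚ
0<1 = ℚₚ.positive⁻¹ 1ℚ

<⇒≱ : ∀ {p q} → p < q → ¬ (q ≤ p)
<⇒≱ p<q q≤p = ℚₚ.<-irrefl refl (ℚₚ.<-≤-trans p<q q≤p)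

p<q⇒0<q-p : ∀ {p q} → p < q → 0ℚ < q - p
p<q⇒0<q-p {p} {q} p<q = subst (_< q - p) (ℚₚ.+-inverseʳ p) (ℚₚ.+-monoˡ-< (- p) p<q)

r≤q-p⇒p+r≤q : ∀ {p q r} → r ≤ q - p → p + r ≤ q
r≤q-p⇒p+r≤q {p} {q} {r} r≤q-p =
  subst₂ _≤_ (ℚₚ.+-comm r p) (cancel q p) (ℚₚ.+-monoˡ-≤ p r≤q-p)
  where cancel : ∀ q p → q - p + p ≡ q
        cancel = solve-∀ ℚ-ring

r≤q-p⇒p≤q-r : ∀ {p q r} → r ≤ q - p → p ≤ q - r
r≤q-p⇒p≤q-r {p} {q} {r} r≤q-p =
  subst (_≤ q - r) (cancel p r) (ℚₚ.+-monoˡ-≤ (- r) (r≤q-p⇒p+r≤q {p} {q} {r} r≤q-p))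
  where cancel : ∀ p r → p + r - r ≡ p
        cancel = solve-∀ ℚ-ring

0≤p*q : ∀ {p q} → 0ℚ ≤ p → 0ℚ ≤ q → 0ℚ ≤ p * q
0≤p*q {p} {q} p≥0 q≥0 = subst (_≤ p * q) (ℚₚ.*-zeroʳ p) (ℚₚ.*-monoˡ-≤-nonNeg p {{nonNegative p≥0}} q≥0)

p-d≤p+d : ∀ {p d} → 0ℚ ≤ d → p - d ≤ p + d
p-d≤p+d {p} d≥0 = ℚₚ.+-monoʳ-≤ p (ℚₚ.≤-trans (ℚₚ.neg-antimono-≤ d≥0) d≥0)

p+r≡p⇒r≡0 : ∀ {p r} → p + r ≡ p → r ≡ 0ℚ
p+r≡p⇒r≡0 {p} {r} p+r≡p = trans (cancel p r) (trans (cong (_- p) p+r≡p) (ℚₚ.+-inverseʳ p))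
  where cancel : ∀ p r → r ≡ p + r - p
        cancel = solve-∀ ℚ-ring

p+r≤p⇒r≤0 : ∀ {p r} → p + r ≤ p → r ≤ 0ℚ
p+r≤p⇒r≤0 {p} {r} p+r≤p =
  subst₂ _≤_ (cancel p r) (ℚₚ.+-inverseˡ p) (ℚₚ.+-monoʳ-≤ (- p) p+r≤p)
  where cancel : ∀ p r → - p + (p + r) ≡ r
        cancel = solve-∀ ℚ-ring

pos*r≤0⇒r≤0 : ∀ {d r} → 0ℚ < d → d * r ≤ 0ℚ → r ≤ 0ℚ
pos*r≤0⇒r≤0 {d} {r} d>0 dr≤0 =
  ℚₚ.*-cancelˡ-≤-pos d {{positive d>0}} (subst (d * r ≤_) (sym (ℚₚ.*-zeroʳ d)) dr≤0)

balanced⇒zero : ∀ {p d r} → 0ℚ < d → p + d * r ≤ p → p + - d * r ≤ p → r ≡ 0ℚ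
balanced⇒zero {p} {d} {r} d>0 up down = ℚₚ.≤-antisym
  (pos*r≤0⇒r≤0 d>0 (p+r≤p⇒r≤0 up))
  (subst₂ _≤_ (ℚₚ.+-inverseʳ r) (ℚₚ.+-identityʳ r)
    (ℚₚ.+-monoʳ-≤ r (pos*r≤0⇒r≤0 d>0 (p+r≤p⇒r≤0 (subst (λ t → p + t ≤ p) (swap d r) down)))))
  where swap : ∀ d r → - d * r ≡ d * - r
        swap = solve-∀ ℚ-ring

p+d*[q-r]≤p⇒q≤r : ∀ {p d q r} → 0ℚ < d → p + d * (q - r) ≤ p → q ≤ r
p+d*[q-r]≤p⇒q≤r {p} {d} {q} {r} d>0 h =
  subst₂ _≤_ (cancel q r) (ℚₚ.+-identityˡ r)
    (ℚₚ.+-monoˡ-≤ r (pos*r≤0⇒r≤0 d>0 (p+r≤p⇒r≤0 h)))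
  where cancel : ∀ q r → q - r + r ≡ q
        cancel = solve-∀ ℚ-ring

0<⊓ : ∀ {p q} → 0ℚ < p → 0ℚ < q → 0ℚ < p ⊓ q
0<⊓ {p} {q} p>0 q>0 with ℚₚ.⊓-sel p q
... | inj₁ eq = subst (0ℚ <_) (sym eq) p>0
... | inj₂ eq = subst (0ℚ <_) (sym eq) q>0

module _ {A : Set} {P : A → Set} (P? : Decidable P) (f : A → ℚ) where

  positiveLowerBound : ∀ (xs : List A) → (∀ {a} → a ∈ xs → P a → 0ℚ < f a) →
                       ∃[ d ] 0ℚ < d × (∀ {a} → a ∈ xs → P a → d ≤ f a)
  positiveLowerBound [] _ = 1ℚ , 0<1 , λ ()
  positiveLowerBound (a ∷ xs) pos with positiveLowerBound xs (pos ∘ there) | P? a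
  ... | d , d>0 , d≤ | no ¬Pa = d , d>0 , bound
    where
    bound : ∀ {b} → b ∈ a ∷ xs → P b → d ≤ f b
    bound (here refl) Pa = ⊥-elim (¬Pa Pa)
    bound (there b∈xs) Pb = d≤ b∈xs Pb
  ... | d , d>0 , d≤ | yes Pa = f a ⊓ d , 0<⊓ (pos (here refl) Pa) d>0 , bound
    where
    bound : ∀ {b} → b ∈ a ∷ xs → P b → f a ⊓ d ≤ f b
    bound (here refl) _ = ℚₚ.p⊓q≤p (f a) d
    bound (there b∈xs) Pb = ℚₚ.≤-trans (ℚₚ.p⊓q≤q (f a) d) (d≤ b∈xs Pb)


module Elements {ℓ : ℕ} (τ : Fin ℓ → ℕ) where

  rk : Elem τ → ℕ
  rk = rank τ

  _⋖_ : Elem τ → Elem τ → Set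
  p ⋖ q = rk q ≡ suc (rk p)

  _≟_ : DecidableEquality (Elem τ)
  bot ≟ bot = yes refl
  bot ≟ mid _ _ = no λ ()
  bot ≟ top = no λ ()
  mid _ _ ≟ bot = no λ ()
  mid i j ≟ mid i′ j′ with i Finₚ.≟ i′
  ... | no i≢i′ = no λ { refl → i≢i′ refl }
  ... | yes refl with j Finₚ.≟ j′
  ...   | yes refl = yes refl
  ...   | no j≢j′ = no λ { refl → j≢j′ refl }
  mid _ _ ≟ top = no λ ()
  top ≟ bot = no λ ()
  top ≟ mid _ _ = no λ ()
  top ≟ top = yes refl

  ∈-allElems : ∀ p → p ∈ allElems τ
  ∈-allElems bot = here refl
  ∈-allElems top = there (here refl)
  ∈-allElems (mid i j) = there (there (∈ₚ.∈-concat⁺′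
    (∈ₚ.∈-map⁺ (mid i) (∈ₚ.∈-allFin j))
    (∈ₚ.∈-map⁺ (λ i → map (mid i) (allFin (τ i))) (∈ₚ.∈-allFin i))))

  all-elems? : {P : Elem τ → Set} → Decidable P → Dec (∀ p → P p)
  all-elems? P? = map′ (λ ps p → All.lookup ps (∈-allElems p)) (λ ps → All.tabulate (λ {p} _ → ps p))
                       (all? P? (allElems τ))

  rank≤suc-ℓ : ∀ p → rk p ℕ.≤ suc ℓ
  rank≤suc-ℓ bot = z≤n
  rank≤suc-ℓ (mid i _) = s≤s (ℕₚ.<⇒≤ (Finₚ.toℕ<n i))
  rank≤suc-ℓ top = ℕₚ.≤-refl

  rank≡suc-ℓ⇒top : ∀ p → rk p ≡ suc ℓ → p ≡ top
  rank≡suc-ℓ⇒top (mid i _) eq = ⊥-elim (ℕₚ.<-irrefl (ℕₚ.suc-injective eq) (Finₚ.toℕ<n i))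
  rank≡suc-ℓ⇒top top _ = refl

  elemOfRank : (∀ i → 0 ℕ.< τ i) → ∀ m → m ℕ.≤ ℓ → ∃[ p ] rk p ≡ suc m
  elemOfRank τ-pos m m≤ℓ with m ℕ.<? ℓ
  ... | yes m<ℓ = mid (fromℕ< m<ℓ) (fromℕ< (τ-pos _)) , cong suc (Finₚ.toℕ-fromℕ< m<ℓ)
  ... | no m≮ℓ = top , cong suc (ℕₚ.≤-antisym (ℕₚ.≮⇒≥ m≮ℓ) m≤ℓ)

  opaque
    uniform-gap : ∀ (w : Point τ) a → (∀ {q} → a ⋖ q → w a < w q) → (∀ {p} → p ⋖ a → w p < w a) →
                  ∃[ d ] 0ℚ < d × (∀ {q} → a ⋖ q → d ≤ w q - w a) × (∀ {p} → p ⋖ a → d ≤ w a - w p)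
    uniform-gap w a gap↑ gap↓
      with positiveLowerBound (λ q → rk q ℕ.≟ suc (rk a)) (λ q → w q - w a) (allElems τ) (λ _ → p<q⇒0<q-p ∘ gap↑)
         | positiveLowerBound (λ p → rk a ℕ.≟ suc (rk p)) (λ p → w a - w p) (allElems τ) (λ _ → p<q⇒0<q-p ∘ gap↓)
    ... | d↑ , d↑>0 , d↑≤ | d↓ , d↓>0 , d↓≤ =
      d↑ ⊓ d↓ , 0<⊓ d↑>0 d↓>0 ,
      (λ {q} a⋖q → ℚₚ.≤-trans (ℚₚ.p⊓q≤p d↑ d↓) (d↑≤ (∈-allElems q) a⋖q)) ,
      (λ {p} p⋖a → ℚₚ.≤-trans (ℚₚ.p⊓q≤q d↑ d↓) (d↓≤ (∈-allElems p) p⋖a))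

  comparable : ∀ {p q} → rk p ≢ rk q → Comparable τ p q
  comparable {p} {q} p≢q with ℕₚ.<-cmp (rk p) (rk q)
  ... | tri< p<q _ _ = inj₁ p<q
  ... | tri≈ _ p≡q _ = ⊥-elim (p≢q p≡q)
  ... | tri> _ _ p>q = inj₂ p>q

  walk-via : ∀ {S a e b} → S e → S b → rk a ≢ rk e → rk e ≢ rk b → Walk τ S a b
  walk-via Se Sb a≢e e≢b = step (comparable a≢e) Se (step (comparable e≢b) Sb here)

  walk-map : ∀ {S S′ : Elem τ → Set} → (∀ {p} → S p → S′ p) → ∀ {p q} → Walk τ S p q → Walk τ S′ p q
  walk-map S⊆S′ here = here
  walk-map S⊆S′ (step p~e Se w) = step p~e (S⊆S′ Se) (walk-map S⊆S′ w)

  lin-comb : ∀ c α β (f g : Point τ) →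
             lin τ c (λ p → α * f p + β * g p) ≡ α * lin τ c f + β * lin τ c g
  lin-comb c α β f g = go (allElems τ)
    where
    Σ[_] : List (Elem τ) → Point τ → ℚ
    Σ[ ps ] h = sumℚ τ (map (λ p → c p * h p) ps)
    go : ∀ ps → Σ[ ps ] (λ p → α * f p + β * g p) ≡ α * Σ[ ps ] f + β * Σ[ ps ] g
    go [] = distrib-0 α β
      where distrib-0 : ∀ α β → 0ℚ ≡ α * 0ℚ + β * 0ℚ
            distrib-0 = solve-∀ ℚ-ring
    go (p ∷ ps) = trans (cong (c p * (α * f p + β * g p) +_) (go ps))
                        (distrib (c p) α β (f p) (g p) (Σ[ ps ] f) (Σ[ ps ] g))
      where distrib : ∀ cp α β fp gp F G →
                      cp * (α * fp + β * gp) + (α * F + β * G) ≡ α * (cp * fp + F) + β * (cp * gp + G)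
            distrib = solve-∀ ℚ-ring

  lin-cong : ∀ c {f g : Point τ} → f ≗ g → lin τ c f ≡ lin τ c g
  lin-cong c f≗g = cong (sumℚ τ) (Listₚ.map-cong (λ p → cong (c p *_) (f≗g p)) (allElems τ))

  Sub : Set
  Sub = Elem τ → Bool

  ind : Sub → Point τ
  ind f p = if f p then 1ℚ else 0ℚ

  ind-true : ∀ f p → f p ≡ true → ind f p ≡ 1ℚ
  ind-true f p eq rewrite eq = refl

  ind-false : ∀ f p → f p ≡ false → ind f p ≡ 0ℚ
  ind-false f p eq rewrite eq = refl

  ind-cong : ∀ {f g} → f ≗ g → ind f ≗ ind g
  ind-cong f≗g p = cong (if_then 1ℚ else 0ℚ) (f≗g p)

  subsets : List (Elem τ) → List Sub
  subsets [] = (λ _ → false) ∷ []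
  subsets (e ∷ es) = map (assign false) (subsets es) ++ map (assign true) (subsets es)
    where assign : Bool → Sub → Sub
          assign v f p = if ⌊ p ≟ e ⌋ then v else f p

  subsets-complete : ∀ es (f : Sub) → ∃[ g ] g ∈ subsets es × (∀ {p} → p ∈ es → g p ≡ f p)
  subsets-complete [] f = (λ _ → false) , here refl , λ ()
  subsets-complete (e ∷ es) f with subsets-complete es f
  ... | g , g∈ , g≡f = g′ , g′∈ , g′≡f
    where
    g′ : Sub
    g′ p = if ⌊ p ≟ e ⌋ then f e else g p
    g′∈ : g′ ∈ subsets (e ∷ es)
    g′∈ with f e
    ... | false = ∈ₚ.∈-++⁺ˡ (∈ₚ.∈-map⁺ _ g∈)
    ... | true = ∈ₚ.∈-++⁺ʳ _ (∈ₚ.∈-map⁺ _ g∈)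
    g′≡f : ∀ {p} → p ∈ e ∷ es → g′ p ≡ f p
    g′≡f {p} p∈ with p ≟ e | p∈
    ... | yes refl | _ = refl
    ... | no p≢e | here p≡e = ⊥-elim (p≢e p≡e)
    ... | no _ | there p∈es = g≡f p∈es

  allSubsets : List Sub
  allSubsets = subsets (allElems τ)

  allSubsets-complete : ∀ f → ∃[ g ] g ∈ allSubsets × g ≗ f
  allSubsets-complete f with subsets-complete (allElems τ) f
  ... | g , g∈ , g≡f = g , g∈ , λ p → g≡f (∈-allElems p)

  Extensional : (Sub → Set) → Set
  Extensional P = ∀ {f g} → f ≗ g → P f → P g

  any-sub? : {P : Sub → Set} → Extensional P → Decidable P → Dec (∃ P)
  any-sub? {P} ext P? = map′ Any.satisfied complete (any? P? allSubsets)
    where complete : ∃ P → Any.Any P allSubsets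
          complete (f , Pf) with allSubsets-complete f
          ... | g , g∈ , g≗f = Any.map (λ { refl → ext (sym ∘ g≗f) Pf }) g∈

  all-sub? : {P : Sub → Set} → Extensional P → Decidable P → Dec (∀ f → P f)
  all-sub? {P} ext P? = map′ sound (λ Pf → All.tabulate (λ {f} _ → Pf f)) (all? P? allSubsets)
    where sound : All P allSubsets → ∀ f → P f
          sound Ps f with allSubsets-complete f
          ... | g , g∈ , g≗f = ext g≗f (All.lookup Ps g∈)


module Polytope {ℓ : ℕ} (τ : Fin ℓ → ℕ) (k : ℕ) where
  open Elements τ

  chainSum-cong : ∀ {y w : Point τ} → (∀ p → InC τ k p → y p ≡ w p) →
                  ∀ s → chainSum τ k y s ≡ chainSum τ k w s
  chainSum-cong {y} {w} y≡w s = cong (sumℚ τ) (Listₚ.map-cong term≡ (allFin ℓ))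
    where
    term≡ : ∀ i → (if toℕ i <ᵇ k then y (mid i (s i)) else 0ℚ) ≡ (if toℕ i <ᵇ k then w (mid i (s i)) else 0ℚ)
    term≡ i with toℕ i <ᵇ k in eq
    ... | true = y≡w (mid i (s i)) (ℕₚ.<ᵇ⇒< (toℕ i) k (subst T (sym eq) tt))
    ... | false = refl

  InO-⋖ : ∀ {p q} → InO τ k p → p ⋖ q → InO τ k q
  InO-⋖ p∈O p⋖q = ℕₚ.<-trans p∈O (ℕₚ.≤-reflexive (sym p⋖q))

  bump : Elem τ → ℚ → Point τ → Point τ
  bump a σ w p = w p + σ * ind (λ p → ⌊ p ≟ a ⌋) p

  bump-at : ∀ a σ w → bump a σ w a ≡ w a + σ
  bump-at a σ w with a ≟ a
  ... | yes _ = cong (w a +_) (ℚₚ.*-identityʳ σ)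
  ... | no a≢a = ⊥-elim (a≢a refl)

  bump-elsewhere : ∀ {a p} σ w → p ≢ a → bump a σ w p ≡ w p
  bump-elsewhere {a} {p} σ w p≢a with p ≟ a
  ... | yes p≡a = ⊥-elim (p≢a p≡a)
  ... | no _ = trans (cong (w p +_) (ℚₚ.*-zeroʳ σ)) (ℚₚ.+-identityʳ (w p))

  -- Only the order inequalities at a involve x_a once rank a ≥ k + 2.
  bump∈𝒪 : ∀ {w a σ} → InPoly τ k w → suc k ℕ.< rk a → a ≢ top →
           (∀ {p} → p ⋖ a → w p ≤ w a + σ) → (∀ {q} → a ⋖ q → w a + σ ≤ w q) →
           InPoly τ k (bump a σ w)
  bump∈𝒪 {w} {a} {σ} w∈𝒪 k+1<a a≢top below above = record
    { bot-zero = trans (low-unchanged z≤n) bot-zero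
    ; top-one = trans (bump-elsewhere σ w (a≢top ∘ sym)) top-one
    ; nonneg = λ p p∈C → subst (0ℚ ≤_) (sym (low-unchanged (ℕₚ.m≤n⇒m≤1+n p∈C))) (nonneg p p∈C)
    ; order = λ p q p∈O q∈O p⋖q → order′ p∈O q∈O p⋖q (p ≟ a) (q ≟ a)
    ; chain = λ s q q-rank →
        subst₂ _≤_ (sym (chainSum-cong (λ p p∈C → low-unchanged (ℕₚ.m≤n⇒m≤1+n p∈C)) s))
                   (sym (low-unchanged (ℕₚ.≤-reflexive q-rank)))
                   (chain s q q-rank) }
    where
    open InPoly w∈𝒪
    low-unchanged : ∀ {p} → rk p ℕ.≤ suc k → bump a σ w p ≡ w p
    low-unchanged p≤ = bump-elsewhere σ w λ { refl → ℕₚ.<⇒≱ k+1<a p≤ }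
    order′ : ∀ {p q} → InO τ k p → InO τ k q → p ⋖ q → Dec (p ≡ a) → Dec (q ≡ a) → bump a σ w p ≤ bump a σ w q
    order′ _ _ p⋖q (yes refl) (yes refl) = ⊥-elim (ℕₚ.1+n≢n (sym p⋖q))
    order′ _ _ p⋖q (yes refl) (no q≢a) = subst₂ _≤_ (sym (bump-at a σ w)) (sym (bump-elsewhere σ w q≢a)) (above p⋖q)
    order′ _ _ p⋖q (no p≢a) (yes refl) = subst₂ _≤_ (sym (bump-elsewhere σ w p≢a)) (sym (bump-at a σ w)) (below p⋖q)
    order′ {p} {q} p∈O q∈O p⋖q (no p≢a) (no q≢a) =
      subst₂ _≤_ (sym (bump-elsewhere σ w p≢a)) (sym (bump-elsewhere σ w q≢a)) (order p q p∈O q∈O p⋖q)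

  module _ (τ-pos : ∀ i → 0 ℕ.< τ i) {x : Point τ} (x∈𝒪 : InPoly τ k x) where
    open InPoly x∈𝒪

    rank<⇒≤ : ∀ {p q} → InO τ k p → rk p ℕ.< rk q → x p ≤ x q
    rank<⇒≤ {p} {q} p∈O p<q = go (rk q ℕ.∸ suc (rk p)) q (sym (ℕₚ.m+[n∸m]≡n p<q))
      where
      p<⇒O : ∀ {e} → rk p ℕ.< rk e → InO τ k e
      p<⇒O p<e = ℕₚ.<-trans p∈O p<e
      go : ∀ d q → rk q ≡ suc (rk p) ℕ.+ d → x p ≤ x q
      go zero q eq = order p q p∈O (p<⇒O (ℕₚ.≤-reflexive (sym p⋖q))) p⋖q
        where p⋖q = trans eq (cong suc (ℕₚ.+-identityʳ (rk p)))
      go (suc d) q eq with elemOfRank τ-pos (rk p ℕ.+ d) rk≤ℓ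
        where rk≤ℓ : rk p ℕ.+ d ℕ.≤ ℓ
              rk≤ℓ = ℕₚ.<⇒≤ (ℕ.s≤s⁻¹ (subst (ℕ._≤ suc ℓ) (trans eq (cong suc (ℕₚ.+-suc (rk p) d))) (rank≤suc-ℓ q)))
      ... | e , e-rank = ℚₚ.≤-trans (go d e e-rank) (order e q (p<⇒O p<e) (p<⇒O p<q′) e⋖q)
        where
        p<e : rk p ℕ.< rk e
        p<e = subst (rk p ℕ.<_) (sym e-rank) (s≤s (ℕₚ.m≤m+n (rk p) d))
        e⋖q : e ⋖ q
        e⋖q = trans eq (cong suc (trans (ℕₚ.+-suc (rk p) d) (sym e-rank)))
        p<q′ : rk p ℕ.< rk q
        p<q′ = ℕₚ.<-trans p<e (ℕₚ.≤-reflexive (sym e⋖q))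

    ≤1 : ∀ {p} → InO τ k p → x p ≤ 1ℚ
    ≤1 {bot} ()
    ≤1 {mid i j} p∈O = subst (x (mid i j) ≤_) top-one (rank<⇒≤ p∈O (s≤s (Finₚ.toℕ<n i)))
    ≤1 {top} _ = ℚₚ.≤-reflexive top-one

    chainSum≤ : ∀ {q} → suc k ℕ.≤ rk q → ∀ s → chainSum τ k x s ≤ x q
    chainSum≤ {q} k<q s with rk q ℕ.≟ suc k
    ... | yes q-rank = chain s q q-rank
    ... | no q-rank≢ with elemOfRank τ-pos k (ℕ.s≤s⁻¹ (ℕₚ.≤-trans k<q (rank≤suc-ℓ q)))
    ...   | e , e-rank = ℚₚ.≤-trans (chain s e e-rank)
                          (rank<⇒≤ (ℕₚ.≤-reflexive (sym e-rank))
                                (subst (ℕ._< rk q) (sym e-rank) (ℕₚ.≤∧≢⇒< k<q (q-rank≢ ∘ sym))))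

  record UpSet (f : Sub) : Set where
    field
      top∈ : f top ≡ true
      ⊆O : ∀ {p} → f p ≡ true → InO τ k p
      upward : ∀ {p q} → p ⋖ q → f p ≡ true → f q ≡ true

    outside-C : ∀ {p} → InC τ k p → f p ≡ false
    outside-C {p} p∈C with f p in fp
    ... | true = ⊥-elim (ℕₚ.≤⇒≯ p∈C (⊆O fp))
    ... | false = refl

  upSet-cong : Extensional UpSet
  upSet-cong {f} {g} f≗g U = record
    { top∈ = trans (sym (f≗g top)) top∈
    ; ⊆O = λ {p} gp → ⊆O (trans (f≗g p) gp)
    ; upward = λ {p} {q} p⋖q gp → trans (sym (f≗g q)) (upward p⋖q (trans (f≗g p) gp)) }
    where open UpSet U

  upSet? : Decidable UpSet
  upSet? f = map′
    (λ (t , s , u) → record { top∈ = t ; ⊆O = λ {p} → s p ; upward = λ {p} {q} → u p q })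
    (λ U → let open UpSet U in top∈ , (λ _ → ⊆O) , (λ _ _ → upward))
    ((f top Boolₚ.≟ true)
      ×-dec all-elems? (λ p → (f p Boolₚ.≟ true) →-dec (k ℕ.<? rk p))
      ×-dec all-elems? (λ p → all-elems? (λ q →
              (rk q ℕ.≟ suc (rk p)) →-dec ((f p Boolₚ.≟ true) →-dec (f q Boolₚ.≟ true)))))

  Separates : Sub → Elem τ → Elem τ → Set
  Separates Φ p q = Φ p ≡ false × Φ q ≡ true

  record Admissible (g : Point τ) : Set where
    field
      vanishes-on-C : ∀ {p} → InC τ k p → g p ≡ 0ℚ
      at-top : g top ≡ 1ℚ
      monotone : ∀ {p q} → p ⋖ q → g p ≤ g q
      nonnegative : ∀ p → 0ℚ ≤ g p

  ind-nonneg : ∀ f p → 0ℚ ≤ ind f p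
  ind-nonneg f p with f p
  ... | true = ℚₚ.<⇒≤ 0<1
  ... | false = ℚₚ.≤-refl

  upSet⇒admissible : ∀ {f} → UpSet f → Admissible (ind f)
  upSet⇒admissible {f} U = record
    { vanishes-on-C = λ {p} p∈C → ind-false f p (outside-C p∈C)
    ; at-top = ind-true f top top∈
    ; monotone = monotone
    ; nonnegative = ind-nonneg f }
    where
    open UpSet U
    monotone : ∀ {p q} → p ⋖ q → ind f p ≤ ind f q
    monotone {p} {q} p⋖q with f p in fp
    ... | false = ind-nonneg f q
    ... | true = ℚₚ.≤-reflexive (sym (ind-true f q (upward p⋖q fp)))

  average : Point τ → Point τ → Point τ
  average g h p = (g p + h p) * ½

  ½-mono-≤ : ∀ {p q} → p ≤ q → p * ½ ≤ q * ½
  ½-mono-≤ = ℚₚ.*-monoʳ-≤-nonNeg ½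

  ½-mono-< : ∀ {p q} → p < q → p * ½ < q * ½
  ½-mono-< = ℚₚ.*-monoˡ-<-pos ½

  average-admissible : ∀ {g h} → Admissible g → Admissible h → Admissible (average g h)
  average-admissible {g} {h} G H = record
    { vanishes-on-C = λ p∈C → cong₂ (λ u v → (u + v) * ½) (G.vanishes-on-C p∈C) (H.vanishes-on-C p∈C)
    ; at-top = cong₂ (λ u v → (u + v) * ½) G.at-top H.at-top
    ; monotone = λ p⋖q → ½-mono-≤ (ℚₚ.+-mono-≤ (G.monotone p⋖q) (H.monotone p⋖q))
    ; nonnegative = λ p → ½-mono-≤ (ℚₚ.+-mono-≤ (G.nonnegative p) (H.nonnegative p)) }
    where module G = Admissible G
          module H = Admissible H

  lin-average : ∀ c g h → lin τ c (average g h) ≡ (lin τ c g + lin τ c h) * ½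
  lin-average c g h = begin
    lin τ c (average g h)                       ≡⟨ lin-cong c (λ p → halves (g p) (h p)) ⟩
    lin τ c (λ p → ½ * g p + ½ * h p)           ≡⟨ lin-comb c ½ ½ g h ⟩
    ½ * lin τ c g + ½ * lin τ c h               ≡⟨ halves (lin τ c g) (lin τ c h) ⟨
    (lin τ c g + lin τ c h) * ½                 ∎
    where
    open ≡-Reasoning
    halves : ∀ u v → (u + v) * ½ ≡ ½ * u + ½ * v
    halves = solve-∀ ℚ-ring

  spread : Point τ → List Sub → Point τ
  spread g [] = g
  spread g (Φ ∷ Φs) = average (spread g Φs) (ind Φ)

  spread-admissible : ∀ {g Φs} → Admissible g → All UpSet Φs → Admissible (spread g Φs)
  spread-admissible G [] = G
  spread-admissible G (U ∷ Us) = average-admissible (spread-admissible G Us) (upSet⇒admissible U)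

  lin-spread : ∀ c g {Φs} → All (λ Φ → lin τ c (ind Φ) ≡ lin τ c g) Φs → lin τ c (spread g Φs) ≡ lin τ c g
  lin-spread c g [] = refl
  lin-spread c g {Φ ∷ Φs} (eq ∷ eqs) = begin
    lin τ c (spread g (Φ ∷ Φs))                       ≡⟨ lin-average c (spread g Φs) (ind Φ) ⟩
    (lin τ c (spread g Φs) + lin τ c (ind Φ)) * ½     ≡⟨ cong₂ (λ u v → (u + v) * ½) (lin-spread c g eqs) eq ⟩
    (lin τ c g + lin τ c g) * ½                       ≡⟨ half-double (lin τ c g) ⟩
    lin τ c g                                         ∎
    where
    open ≡-Reasoning
    half-double : ∀ u → (u + u) * ½ ≡ u
    half-double = solve-∀ ℚ-ring

  spread-separates : ∀ {g Φs Φ p q} → Admissible g → All UpSet Φs → p ⋖ q →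
                     Φ ∈ Φs → Separates Φ p q → spread g Φs p < spread g Φs q
  spread-separates {Φ = Φ} {p} {q} G (U ∷ Us) p⋖q (here refl) (Φp , Φq) =
    ½-mono-< (ℚₚ.+-mono-≤-< (Admissible.monotone (spread-admissible G Us) p⋖q)
                            (subst₂ _<_ (sym (ind-false Φ p Φp)) (sym (ind-true Φ q Φq)) 0<1))
  spread-separates G (U ∷ Us) p⋖q (there Φ∈) sep =
    ½-mono-< (ℚₚ.+-mono-<-≤ (spread-separates G Us p⋖q Φ∈ sep)
                            (Admissible.monotone (upSet⇒admissible U) p⋖q))


module Face {ℓ : ℕ} (τ : Fin ℓ → ℕ) (τ-pos : ∀ i → 0 ℕ.< τ i) (k : ℕ) (k<ℓ : k ℕ.< ℓ)
            (c : Point τ) (b : ℚ) (valid : ValidIneq τ k c b) where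
  open Elements τ
  open Polytope τ k

  L : Point τ → ℚ
  L = lin τ c

  Tied : Elem τ → Elem τ → Set
  Tied p q = ∀ x → InFace τ k c b x → x p ≡ x q

  Optimal : Sub → Set
  Optimal Φ = UpSet Φ × (∀ Ψ → UpSet Ψ → L (ind Ψ) ≤ L (ind Φ))

  optimal-cong : Extensional Optimal
  optimal-cong Φ≗Φ′ (U , max) =
    upSet-cong Φ≗Φ′ U , λ Ψ UΨ → subst (L (ind Ψ) ≤_) (lin-cong c (ind-cong Φ≗Φ′)) (max Ψ UΨ)

  optimal? : Decidable Optimal
  optimal? Φ = upSet? Φ ×-dec all-sub? ext (λ Ψ → upSet? Ψ →-dec (L (ind Ψ) ℚₚ.≤? L (ind Φ)))
    where ext : Extensional (λ Ψ → UpSet Ψ → L (ind Ψ) ≤ L (ind Φ))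
          ext Ψ≗Ψ′ le UΨ′ = subst (_≤ L (ind Φ)) (lin-cong c (ind-cong Ψ≗Ψ′)) (le (upSet-cong (sym ∘ Ψ≗Ψ′) UΨ′))

  OptimallySeparated : Elem τ → Elem τ → Set
  OptimallySeparated p q = ∃[ Φ ] Optimal Φ × Separates Φ p q

  optimallySeparated? : ∀ p q → Dec (OptimallySeparated p q)
  optimallySeparated? p q = any-sub? ext (λ Φ → optimal? Φ ×-dec (Φ p Boolₚ.≟ false) ×-dec (Φ q Boolₚ.≟ true))
    where ext : Extensional (λ Φ → Optimal Φ × Separates Φ p q)
          ext Φ≗Φ′ (O , Φp , Φq) = optimal-cong Φ≗Φ′ O , trans (sym (Φ≗Φ′ p)) Φp , trans (sym (Φ≗Φ′ q)) Φq

  -- For x on the face, the elements of O above a level θ form an up-set;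
  -- lowering them by a small ε and then pushing in an admissible direction g
  -- stays in the polytope, which makes that up-set optimal.
  module Threshold {x} (x∈F : InFace τ k c b x) (θ : ℚ)
                   (chain≤θ : ∀ s → chainSum τ k x s ≤ θ) (θ<1 : θ < 1ℚ) where
    open InPoly (proj₁ x∈F)

    above : Sub
    above p = ⌊ (k ℕ.<? rk p) ×-dec (θ ℚₚ.<? x p) ⌋

    AboveView : Elem τ → Set
    AboveView p = (above p ≡ true × InO τ k p × θ < x p) ⊎ (above p ≡ false × (InO τ k p → x p ≤ θ))

    above-view : ∀ p → AboveView p
    above-view p with k ℕ.<? rk p | θ ℚₚ.<? x p
    ... | yes p∈O | yes θ<x = inj₁ (refl , p∈O , θ<x)
    ... | yes _ | no θ≮x = inj₂ (refl , λ _ → ℚₚ.≮⇒≥ θ≮x)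
    ... | no p∉O | _ = inj₂ (refl , λ p∈O → ⊥-elim (p∉O p∈O))

    above-true⁻¹ : ∀ {p} → above p ≡ true → InO τ k p × θ < x p
    above-true⁻¹ {p} eq with above-view p
    ... | inj₁ (_ , spec) = spec
    ... | inj₂ (neq , _) with () ← trans (sym neq) eq

    above-true : ∀ {p} → InO τ k p → θ < x p → above p ≡ true
    above-true {p} p∈O θ<x with above-view p
    ... | inj₁ (eq , _) = eq
    ... | inj₂ (_ , x≤θ) = ⊥-elim (<⇒≱ θ<x (x≤θ p∈O))

    above-false : ∀ {p} → x p ≤ θ → above p ≡ false
    above-false {p} x≤θ with above-view p
    ... | inj₁ (_ , _ , θ<x) = ⊥-elim (<⇒≱ θ<x x≤θ)
    ... | inj₂ (eq , _) = eq

    above-upSet : UpSet above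
    above-upSet = record
      { top∈ = above-true (s≤s (ℕₚ.<⇒≤ k<ℓ)) (subst (θ <_) (sym top-one) θ<1)
      ; ⊆O = proj₁ ∘ above-true⁻¹
      ; upward = upward }
      where
      upward : ∀ {p q} → p ⋖ q → above p ≡ true → above q ≡ true
      upward {p} {q} p⋖q eq with above-true⁻¹ eq
      ... | p∈O , θ<x = above-true (InO-⋖ p∈O p⋖q) (ℚₚ.<-≤-trans θ<x (order p q p∈O (InO-⋖ p∈O p⋖q) p⋖q))

    -- Opaque (like the other existence lemmas below): unfolding these witnesses
    -- makes type checking normalise sums of rationals and run out of memory.
    opaque
      ε-spec : ∃[ ε ] 0ℚ < ε × (∀ {p} → above p ≡ true → ε ≤ x p - θ)
      ε-spec with positiveLowerBound (λ p → above p Boolₚ.≟ true) (λ p → x p - θ) (allElems τ)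
                    (λ _ eq → p<q⇒0<q-p (proj₂ (above-true⁻¹ eq)))
      ... | ε , ε>0 , ε≤ = ε , ε>0 , λ {p} → ε≤ (∈-allElems p)

    ε : ℚ
    ε = proj₁ ε-spec

    ε>0 : 0ℚ < ε
    ε>0 = proj₁ (proj₂ ε-spec)

    ε≥0 : 0ℚ ≤ ε
    ε≥0 = ℚₚ.<⇒≤ ε>0

    θ≤x-ε : ∀ {p} → above p ≡ true → θ ≤ x p - ε
    θ≤x-ε {p} ap = r≤q-p⇒p≤q-r {θ} {x p} {ε} (proj₂ (proj₂ ε-spec) ap)

    lowered : Point τ
    lowered p = x p - ε * ind above p

    lowered-above : ∀ {p} → above p ≡ true → lowered p ≡ x p - ε
    lowered-above {p} eq = trans (cong (λ t → x p - ε * t) (ind-true above p eq)) (times-1 (x p) ε)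
      where times-1 : ∀ u e → u - e * 1ℚ ≡ u - e
            times-1 = solve-∀ ℚ-ring

    lowered-not-above : ∀ {p} → above p ≡ false → lowered p ≡ x p
    lowered-not-above {p} eq = trans (cong (λ t → x p - ε * t) (ind-false above p eq)) (times-0 (x p) ε)
      where times-0 : ∀ u e → u - e * 0ℚ ≡ u
            times-0 = solve-∀ ℚ-ring

    lowered-monotone : ∀ {p q} → InO τ k p → p ⋖ q → lowered p ≤ lowered q
    lowered-monotone {p} {q} p∈O p⋖q = by-cases (above-view p) (above-view q)
      where
      q∈O = InO-⋖ p∈O p⋖q
      x-order = order p q p∈O q∈O p⋖q
      by-cases : AboveView p → AboveView q → lowered p ≤ lowered q
      by-cases (inj₁ (ap , _)) (inj₁ (aq , _)) =
        subst₂ _≤_ (sym (lowered-above ap)) (sym (lowered-above aq)) (ℚₚ.+-monoˡ-≤ (- ε) x-order)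
      by-cases (inj₂ (ap , _)) (inj₂ (aq , _)) =
        subst₂ _≤_ (sym (lowered-not-above ap)) (sym (lowered-not-above aq)) x-order
      by-cases (inj₂ (ap , x≤θ)) (inj₁ (aq , _)) =
        subst₂ _≤_ (sym (lowered-not-above ap)) (sym (lowered-above aq))
          (ℚₚ.≤-trans (x≤θ p∈O) (θ≤x-ε aq))
      by-cases (inj₁ (_ , _ , θ<x)) (inj₂ (_ , x≤θ)) = ⊥-elim (<⇒≱ (ℚₚ.<-≤-trans θ<x x-order) (x≤θ q∈O))

    lowered-on-C : ∀ {p} → InC τ k p → lowered p ≡ x p
    lowered-on-C p∈C = lowered-not-above (UpSet.outside-C above-upSet p∈C)

    chainSum≤lowered : ∀ s {q} → rk q ≡ suc k → chainSum τ k x s ≤ lowered q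
    chainSum≤lowered s {q} q-rank with above-view q
    ... | inj₁ (aq , _) = subst (_ ≤_) (sym (lowered-above aq))
                            (ℚₚ.≤-trans (chain≤θ s) (θ≤x-ε aq))
    ... | inj₂ (aq , _) = subst (_ ≤_) (sym (lowered-not-above aq)) (chain s q q-rank)

    push : Point τ → Point τ
    push g p = lowered p + ε * g p

    module _ {g} (G : Admissible g) where
      open Admissible G

      push-on-C : ∀ {p} → InC τ k p → push g p ≡ x p
      push-on-C {p} p∈C = begin
        lowered p + ε * g p   ≡⟨ cong₂ (λ u v → u + ε * v) (lowered-on-C p∈C) (vanishes-on-C p∈C) ⟩
        x p + ε * 0ℚ          ≡⟨ plus-0 (x p) ε ⟩
        x p                   ∎
        where
        open ≡-Reasoning
        plus-0 : ∀ u e → u + e * 0ℚ ≡ u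
        plus-0 = solve-∀ ℚ-ring

      push-top : push g top ≡ 1ℚ
      push-top = begin
        lowered top + ε * g top   ≡⟨ cong₂ (λ u v → u + ε * v) (lowered-above (UpSet.top∈ above-upSet)) at-top ⟩
        x top - ε + ε * 1ℚ        ≡⟨ cong (λ u → u - ε + ε * 1ℚ) top-one ⟩
        1ℚ - ε + ε * 1ℚ           ≡⟨ cancel ε ⟩
        1ℚ                        ∎
        where
        open ≡-Reasoning
        cancel : ∀ e → 1ℚ - e + e * 1ℚ ≡ 1ℚ
        cancel = solve-∀ ℚ-ring

      push-monotone : ∀ {p q} → InO τ k p → p ⋖ q → push g p ≤ push g q
      push-monotone p∈O p⋖q =
        ℚₚ.+-mono-≤ (lowered-monotone p∈O p⋖q) (ℚₚ.*-monoˡ-≤-nonNeg ε {{nonNegative ε≥0}} (monotone p⋖q))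

      push-strict : ∀ {p q} → InO τ k p → p ⋖ q → g p < g q → push g p < push g q
      push-strict p∈O p⋖q g< =
        ℚₚ.+-mono-≤-< (lowered-monotone p∈O p⋖q) (ℚₚ.*-monoʳ-<-pos ε {{positive ε>0}} g<)

      push∈𝒪 : InPoly τ k (push g)
      push∈𝒪 = record
        { bot-zero = trans (push-on-C z≤n) bot-zero
        ; top-one = push-top
        ; nonneg = λ p p∈C → subst (0ℚ ≤_) (sym (push-on-C p∈C)) (nonneg p p∈C)
        ; order = λ p q p∈O _ p⋖q → push-monotone p∈O p⋖q
        ; chain = λ s q q-rank → subst (_≤ push g q) (sym (chainSum-cong (λ p → push-on-C) s))
            (ℚₚ.≤-trans (chainSum≤lowered s q-rank)
              (subst (_≤ push g q) (ℚₚ.+-identityʳ (lowered q))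
                (ℚₚ.+-monoʳ-≤ (lowered q) (0≤p*q ε≥0 (nonnegative q))))) }

      lin-push : L (push g) ≡ L x + ε * (L g - L (ind above))
      lin-push = begin
        L (push g)                                                  ≡⟨ lin-cong c (λ p → expand (x p) ε (g p) (ind above p)) ⟩
        L (λ p → 1ℚ * x p + ε * (1ℚ * g p + - 1ℚ * ind above p))    ≡⟨ lin-comb c 1ℚ ε x _ ⟩
        1ℚ * L x + ε * L (λ p → 1ℚ * g p + - 1ℚ * ind above p)      ≡⟨ cong (λ t → 1ℚ * L x + ε * t) (lin-comb c 1ℚ (- 1ℚ) g (ind above)) ⟩
        1ℚ * L x + ε * (1ℚ * L g + - 1ℚ * L (ind above))            ≡⟨ regroup (L x) ε (L g) (L (ind above)) ⟨
        L x + ε * (L g - L (ind above))                             ∎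
        where
        open ≡-Reasoning
        expand : ∀ u e v w → u - e * w + e * v ≡ 1ℚ * u + e * (1ℚ * v + - 1ℚ * w)
        expand = solve-∀ ℚ-ring
        regroup : ∀ u e v w → u + e * (v - w) ≡ 1ℚ * u + e * (1ℚ * v + - 1ℚ * w)
        regroup = solve-∀ ℚ-ring

      above-maximal : L g ≤ L (ind above)
      above-maximal = p+d*[q-r]≤p⇒q≤r ε>0 (subst₂ _≤_ lin-push (sym (proj₂ x∈F)) (valid (push g) push∈𝒪))

      push∈F : L g ≡ L (ind above) → InFace τ k c b (push g)
      push∈F eq = push∈𝒪 , (begin
        L (push g)                                 ≡⟨ lin-push ⟩
        L x + ε * (L g - L (ind above))            ≡⟨ cong (λ t → L x + ε * (t - L (ind above))) eq ⟩
        L x + ε * (L (ind above) - L (ind above))  ≡⟨ cancel (L x) ε (L (ind above)) ⟩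
        L x                                        ≡⟨ proj₂ x∈F ⟩
        b                                          ∎)
        where
        open ≡-Reasoning
        cancel : ∀ u e v → u + e * (v - v) ≡ u
        cancel = solve-∀ ℚ-ring

    above-optimal : Optimal above
    above-optimal = above-upSet , λ Ψ UΨ → above-maximal (upSet⇒admissible UΨ)

  separated-if-< : ∀ {x} → InFace τ k c b x → ∀ {p q} → InO τ k p → InO τ k q →
                   x p < x q → OptimallySeparated p q
  separated-if-< {x} x∈F {p} {q} p∈O q∈O xp<xq =
    above , above-optimal , above-false ℚₚ.≤-refl , above-true q∈O xp<xq
    where open Threshold x∈F (x p) (chainSum≤ τ-pos (proj₁ x∈F) p∈O)
                         (ℚₚ.<-≤-trans xp<xq (≤1 τ-pos (proj₁ x∈F) q∈O))

  tied-unless-separated : ∀ {p q} → p ⋖ q → InO τ k p → ¬ OptimallySeparated p q → Tied p q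
  tied-unless-separated {p} {q} p⋖q p∈O ¬sep x x∈F with ℚₚ.<-cmp (x p) (x q)
  ... | tri< xp<xq _ _ = ⊥-elim (¬sep (separated-if-< x∈F p∈O (InO-⋖ p∈O p⋖q) xp<xq))
  ... | tri≈ _ xp≡xq _ = xp≡xq
  ... | tri> _ _ xp>xq = ⊥-elim (<⇒≱ xp>xq (InPoly.order (proj₁ x∈F) p q p∈O (InO-⋖ p∈O p⋖q) p⋖q))

  optimalSets : List Sub
  optimalSets = filter optimal? allSubsets

  optimalSets-optimal : ∀ {Φ} → Φ ∈ optimalSets → Optimal Φ
  optimalSets-optimal Φ∈ = proj₂ (∈ₚ.∈-filter⁻ optimal? {xs = allSubsets} Φ∈)

  optimalSets-separate : ∀ {p q} → OptimallySeparated p q → ∃[ Φ ] Φ ∈ optimalSets × Separates Φ p q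
  optimalSets-separate {p} {q} (Φ , Φ-opt , Φp , Φq) with allSubsets-complete Φ
  ... | Φ′ , Φ′∈ , Φ′≗Φ =
    Φ′ , ∈ₚ.∈-filter⁺ optimal? Φ′∈ (optimal-cong (sym ∘ Φ′≗Φ) Φ-opt) , trans (Φ′≗Φ p) Φp , trans (Φ′≗Φ q) Φq

  -- Averaging all optimal up-sets into the threshold direction gives one face
  -- point that realises every optimal separation at once.
  opaque
    strict-point : ∀ {x a} → InFace τ k c b x → suc k ℕ.< rk a → x a < 1ℚ →
                   (∀ {q} → a ⋖ q → OptimallySeparated a q) → (∀ {p} → p ⋖ a → OptimallySeparated p a) →
                   ∃[ w ] InFace τ k c b w × (∀ {q} → a ⋖ q → w a < w q) × (∀ {p} → p ⋖ a → w p < w a)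
    strict-point {x} {a} x∈F k+1<a xa<1 sep↑ sep↓ = push g , push∈F G (lin-spread c (ind above) lin-optimal) , gap↑ , gap↓
      where
      a∈O : InO τ k a
      a∈O = ℕₚ.<-trans (ℕₚ.n<1+n k) k+1<a
      open Threshold x∈F (x a) (chainSum≤ τ-pos (proj₁ x∈F) a∈O) xa<1
      optimal-upSets : All UpSet optimalSets
      optimal-upSets = All.tabulate (proj₁ ∘ optimalSets-optimal)
      lin-optimal : All (λ Φ → L (ind Φ) ≡ L (ind above)) optimalSets
      lin-optimal = All.tabulate λ Φ∈ → let (UΦ , maxΦ) = optimalSets-optimal Φ∈ in
        ℚₚ.≤-antisym (above-maximal (upSet⇒admissible UΦ)) (maxΦ above above-upSet)
      g : Point τ
      g = spread (ind above) optimalSets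
      G : Admissible g
      G = spread-admissible (upSet⇒admissible above-upSet) optimal-upSets
      g-separates : ∀ {p q} → p ⋖ q → OptimallySeparated p q → g p < g q
      g-separates p⋖q sep with optimalSets-separate sep
      ... | Φ , Φ∈ , Φ-sep = spread-separates (upSet⇒admissible above-upSet) optimal-upSets p⋖q Φ∈ Φ-sep
      gap↑ : ∀ {q} → a ⋖ q → push g a < push g q
      gap↑ a⋖q = push-strict G a∈O a⋖q (g-separates a⋖q (sep↑ a⋖q))
      gap↓ : ∀ {p} → p ⋖ a → push g p < push g a
      gap↓ {p} p⋖a = push-strict G p∈O p⋖a (g-separates p⋖a (sep↓ p⋖a))
        where p∈O : InO τ k p
              p∈O = ℕ.s≤s⁻¹ (subst (suc k ℕ.<_) p⋖a k+1<a)

  free-coordinate : ∀ {w a d} → InFace τ k c b w → suc k ℕ.< rk a → a ≢ top → 0ℚ < d →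
                    (∀ {q} → a ⋖ q → d ≤ w q - w a) → (∀ {p} → p ⋖ a → d ≤ w a - w p) →
                    InFace τ k c b (bump a d w)
  free-coordinate {w} {a} {d} (w∈𝒪 , Lw≡b) k+1<a a≢top d>0 gap↑ gap↓ =
    bump∈𝒪 w∈𝒪 k+1<a a≢top lower⁺ upper⁺ , (begin
      L (bump a d w)  ≡⟨ lin-bump d ⟩
      L w + d * κ     ≡⟨ cong (λ t → L w + d * t) κ≡0 ⟩
      L w + d * 0ℚ    ≡⟨ cong (L w +_) (ℚₚ.*-zeroʳ d) ⟩
      L w + 0ℚ        ≡⟨ ℚₚ.+-identityʳ (L w) ⟩
      L w             ≡⟨ Lw≡b ⟩
      b               ∎)
    where
    open ≡-Reasoning
    κ : ℚ
    κ = L (ind (λ p → ⌊ p ≟ a ⌋))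
    lin-bump : ∀ σ → L (bump a σ w) ≡ L w + σ * κ
    lin-bump σ = trans (lin-cong c (λ p → one-times (w p) σ _))
                   (trans (lin-comb c 1ℚ σ w _) (sym (one-times (L w) σ κ)))
      where one-times : ∀ u s v → u + s * v ≡ 1ℚ * u + s * v
            one-times = solve-∀ ℚ-ring
    d≥0 = ℚₚ.<⇒≤ d>0
    lower⁻ : ∀ {p} → p ⋖ a → w p ≤ w a - d
    lower⁻ {p} p⋖a = r≤q-p⇒p≤q-r {w p} {w a} {d} (gap↓ p⋖a)
    upper⁺ : ∀ {q} → a ⋖ q → w a + d ≤ w q
    upper⁺ {q} a⋖q = r≤q-p⇒p+r≤q {w a} {w q} {d} (gap↑ a⋖q)
    lower⁺ : ∀ {p} → p ⋖ a → w p ≤ w a + d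
    lower⁺ p⋖a = ℚₚ.≤-trans (lower⁻ p⋖a) (p-d≤p+d {w a} d≥0)
    upper⁻ : ∀ {q} → a ⋖ q → w a - d ≤ w q
    upper⁻ a⋖q = ℚₚ.≤-trans (p-d≤p+d {w a} d≥0) (upper⁺ a⋖q)
    bumped-value : ∀ σ → (∀ {p} → p ⋖ a → w p ≤ w a + σ) → (∀ {q} → a ⋖ q → w a + σ ≤ w q) →
                   L w + σ * κ ≤ L w
    bumped-value σ lower upper =
      subst₂ _≤_ (lin-bump σ) (sym Lw≡b) (valid _ (bump∈𝒪 w∈𝒪 k+1<a a≢top lower upper))
    κ≡0 : κ ≡ 0ℚ
    κ≡0 = balanced⇒zero d>0 (bumped-value d lower⁺ upper⁺) (bumped-value (- d) lower⁻ upper⁻)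

  Unseparated : Elem τ → Elem τ → Set
  Unseparated a q = (a ⋖ q × ¬ OptimallySeparated a q) ⊎ (q ⋖ a × ¬ OptimallySeparated q a)

  unseparated? : ∀ a → Decidable (Unseparated a)
  unseparated? a q = ((rk q ℕ.≟ suc (rk a)) ×-dec ¬? (optimallySeparated? a q))
                 ⊎-dec ((rk a ℕ.≟ suc (rk q)) ×-dec ¬? (optimallySeparated? q a))

  -- If every cover relation at a is optimally separated, a face point with x_a < 1
  -- could be moved in the coordinate a alone, breaking the tie with a′.
  tied-to-top : ∀ {a a′} → a ≢ a′ → suc k ℕ.< rk a → a ≢ top →
                Tied a a′ →
                (∀ {q} → a ⋖ q → OptimallySeparated a q) → (∀ {p} → p ⋖ a → OptimallySeparated p a) →
                Tied a top
  tied-to-top {a} {a′} a≢a′ k+1<a a≢top tied sep↑ sep↓ x x∈F with ℚₚ.<-cmp (x a) 1ℚ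
  ... | tri< xa<1 _ _ = ⊥-elim (a-free xa<1)
    where
    a-free : ¬ (x a < 1ℚ)
    a-free xa<1 with strict-point x∈F k+1<a xa<1 sep↑ sep↓
    ... | w , w∈F , gap↑ , gap↓ with uniform-gap w a gap↑ gap↓
    ...   | d , d>0 , d↑ , d↓ = ℚₚ.<-irrefl (sym (p+r≡p⇒r≡0 w[a]+d≡w[a])) d>0
      where
      w[a]+d≡w[a] : w a + d ≡ w a
      w[a]+d≡w[a] = begin
        w a + d           ≡⟨ bump-at a d w ⟨
        bump a d w a      ≡⟨ tied _ (free-coordinate w∈F k+1<a a≢top d>0 d↑ d↓) ⟩
        bump a d w a′     ≡⟨ bump-elsewhere d w (a≢a′ ∘ sym) ⟩
        w a′              ≡⟨ tied w w∈F ⟨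
        w a               ∎
        where open ≡-Reasoning
  ... | tri≈ _ xa≡1 _ = trans xa≡1 (sym (InPoly.top-one (proj₁ x∈F)))
  ... | tri> _ _ xa>1 = ⊥-elim (<⇒≱ xa>1 (≤1 τ-pos (proj₁ x∈F) (ℕₚ.<-trans (ℕₚ.n<1+n k) k+1<a)))

  tied-partner : ∀ {a a′} → a ≢ a′ → rk a ≡ rk a′ → suc (suc k) ℕ.< rk a → Tied a a′ →
                 ∃[ q ] rk q ≢ rk a × suc k ℕ.< rk q × Tied a q
  tied-partner {a} {a′} a≢a′ rank≡ k+2<a tied = by-cases (any? (unseparated? a) (allElems τ))
    where
    k+1<a : suc k ℕ.< rk a
    k+1<a = ℕₚ.<-trans (ℕₚ.n<1+n (suc k)) k+2<a
    a∈O : InO τ k a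
    a∈O = ℕₚ.<-trans (ℕₚ.n<1+n k) k+1<a
    a≢top : a ≢ top
    a≢top a≡top = a≢a′ (trans a≡top (sym (rank≡suc-ℓ⇒top a′ (trans (sym rank≡) (cong rk a≡top)))))
    Partner : Set
    Partner = ∃[ q ] rk q ≢ rk a × suc k ℕ.< rk q × Tied a q
    partner : ∃ (Unseparated a) → Partner
    partner (q , inj₁ (a⋖q , ¬sep)) =
      q , (λ e → ℕₚ.1+n≢n (trans (sym a⋖q) e)) , ℕₚ.<-trans k+1<a (ℕₚ.≤-reflexive (sym a⋖q)) ,
      tied-unless-separated a⋖q a∈O ¬sep
    partner (q , inj₂ (q⋖a , ¬sep)) =
      q , (λ e → ℕₚ.1+n≢n (trans (sym q⋖a) (sym e))) , k+1<q ,
      λ x x∈F → sym (tied-unless-separated q⋖a (ℕₚ.<-trans (ℕₚ.n<1+n k) k+1<q) ¬sep x x∈F)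
      where k+1<q : suc k ℕ.< rk q
            k+1<q = ℕ.s≤s⁻¹ (subst (suc (suc k) ℕ.<_) q⋖a k+2<a)
    by-cases : Dec (Any.Any (Unseparated a) (allElems τ)) → Partner
    by-cases (yes some) = partner (Any.satisfied some)
    by-cases (no none) =
      top , (λ e → a≢top (rank≡suc-ℓ⇒top a (sym e))) , s≤s k<ℓ ,
      tied-to-top a≢a′ k+1<a a≢top tied sep↑ sep↓
      where
      sep↑ : ∀ {q} → a ⋖ q → OptimallySeparated a q
      sep↑ {q} a⋖q with optimallySeparated? a q
      ... | yes sep = sep
      ... | no ¬sep = ⊥-elim (none (Any.map (λ { refl → inj₁ (a⋖q , ¬sep) }) (∈-allElems q)))
      sep↓ : ∀ {p} → p ⋖ a → OptimallySeparated p a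
      sep↓ {p} p⋖a with optimallySeparated? p a
      ... | yes sep = sep
      ... | no ¬sep = ⊥-elim (none (Any.map (λ { refl → inj₂ (p⋖a , ¬sep) }) (∈-allElems p)))

  π''-connected : ∀ p → InO τ k p → Qualifies τ k c b p → Connected τ (π''Block τ k c b p)
  π''-connected p p∈O (r , p~r , k+2<r) a a′ a∈K a′∈K with rk a ℕ.≟ rk a′
  ... | no rank≢ = step (comparable rank≢) a′∈K here
  ... | yes rank≡ with rk a ℕ.≟ rk r
  ...   | no a≢r = walk-via r∈K a′∈K a≢r (a≢r ∘ trans rank≡ ∘ sym)
    where r∈K = p~r , ℕₚ.<-trans (ℕₚ.n<1+n (suc k)) k+2<r
  ...   | yes a≡r with a ≟ a′
  ...     | yes refl = here
  ...     | no a≢a′ with tied-partner a≢a′ rank≡ (subst (suc (suc k) ℕ.<_) (sym a≡r) k+2<r) tied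
    where
    tied : Tied a a′
    tied x x∈F = trans (sym (proj₂ (proj₂ (proj₁ a∈K)) x x∈F)) (proj₂ (proj₂ (proj₁ a′∈K)) x x∈F)
  ...       | q , q≢a , k+1<q , a~q = walk-via q∈K a′∈K (q≢a ∘ sym) (q≢a ∘ flip trans (sym rank≡))
    where
    q∈K : π''Block τ k c b p q
    q∈K = (p∈O , ℕₚ.<-trans (ℕₚ.n<1+n k) k+1<q ,
           λ x x∈F → trans (proj₂ (proj₂ (proj₁ a∈K)) x x∈F) (a~q x x∈F)) , k+1<q

  π'-connected : ∀ p → InO τ (suc k) p → Connected τ (π'Block τ k c b p)
  π'-connected p p∈O′ a a′ (inj₁ (Qp , a∈K)) (inj₁ (_ , a′∈K)) =
    walk-map inj₁′ (π''-connected p (ℕₚ.<⇒≤ p∈O′) Qp a a′ a∈K a′∈K)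
    where inj₁′ : ∀ {q} → π''Block τ k c b p q → π'Block τ k c b p q
          inj₁′ q∈K = inj₁ (Qp , q∈K)
  π'-connected p _ a a′ (inj₁ (Qp , _)) (inj₂ (¬Qp , _)) = ⊥-elim (¬Qp Qp)
  π'-connected p _ a a′ (inj₂ (¬Qp , _)) (inj₁ (Qp , _)) = ⊥-elim (¬Qp Qp)
  π'-connected p _ a a′ (inj₂ (_ , refl)) (inj₂ (_ , refl)) = here

lemma4p3 : (ℓ : ℕ) (τ : Fin ℓ → ℕ) → (∀ i → 0 ℕ.< τ i) →
           (k : ℕ) → k ℕ.< ℓ →
           (c : Point τ) (b : ℚ) → ValidIneq τ k c b →
           ∃ (λ x → InFace τ k c b x) →
           (∀ p → InO τ k p → Qualifies τ k c b p →
              Connected τ (π''Block τ k c b p))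
           × (∀ p → InO τ (suc k) p → Connected τ (π'Block τ k c b p))
lemma4p3 ℓ τ τ-pos k k<ℓ c b valid _ = π''-connected , π'-connected
  where open Face τ τ-pos k k<ℓ c b valid
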